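{- Let $(V,\chi)$ be a complete colored directed graph with loops, where $\chi\colon V^2\to C$ assigns loops colors different from those of non-loops. If $k\ge 2$, then $\chi_{\mathsf{WL}}^{\lceil\log k\rceil}\preceq \chi_{\mathcal{W}[k]}$.
   Context: For a coloring $\chi$ of $V^2$ and vertices $v_1,\dots,v_m$ write $\overline{\chi}(v_1,\dots,v_m)=(\chi(v_1,v_2),\chi(v_2,v_3),\dots,\chi(v_{m-1},v_m))$. The $2$-dimensional Weisfeiler-Leman refinement is $\chi_{\mathsf{WL}}(u,v)=\{\!\{\overline\chi(u,w,v): w\in V\}\!\}$, and $\chi_{\mathsf{WL}}^{m}$ denotes $m$-fold iteration. For $k\ge 2$ the $k$-walk refinement is $\chi_{\mathcal{W}[k]}(u,v)=\{\!\{\overline\chi(u,w_1,\dots,w_{k-1},v): w_1,\dots,w_{k-1}\in V\}\!\}$ (multiset). For colorings $\chi,\chi'$ of $V^2$, $\chi\preceq\chi'$ means the partition of $V^2$ into color classes of $\chi$ is finer than or equal to that of $\chi'$. Here $\log$ is the logarithm to base $2$. -}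

module Defs where

open import Level using (0ℓ)
open import Data.Nat using (ℕ; zero; suc)
open import Data.Fin using (Fin)
open import Data.List using (List; []; _∷_; map; concatMap; _++_)
open import Data.List.Base using (allFin)
open import Data.Product using (_×_; _,_)
open import Data.Product.Relation.Binary.Pointwise.NonDependent using (×-setoid)
open import Relation.Binary using (Setoid; Rel)
open import Relation.Binary.PropositionalEquality using (_≡_; _≢_)
import Data.List.Relation.Binary.Permutation.Setoid as PermS
open import Data.List.Relation.Binary.Permutation.Propositional using (_↭_)

-- Vertex set V = Fin n.  A coloring of V² with colors in a setoid S
-- (colors compared up to the setoid equality; for the input coloring
-- the setoid is propositional equality on C).
Coloring : ℕ → Setoid 0ℓ 0ℓ → Set
Coloring n S = Fin n → Fin n → Setoid.Carrier S

_⪯_ : ∀ {n} {S T : Setoid 0ℓ 0ℓ} → Coloring n S → Coloring n T → Set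
_⪯_ {n} {S} {T} χ χ' =
  ∀ (a b c d : Fin n) → Setoid._≈_ S (χ a b) (χ c d) → Setoid._≈_ T (χ' a b) (χ' c d)

-- Colors of a WL refinement: multisets (lists up to permutation) of pairs
-- of old colors, where old colors are compared by the old setoid.
WLSetoid : Setoid 0ℓ 0ℓ → Setoid 0ℓ 0ℓ
WLSetoid S = PermS.↭-setoid (×-setoid S S)

wlStep : ∀ {n} {S : Setoid 0ℓ 0ℓ} → Coloring n S → Coloring n (WLSetoid S)
wlStep {n} χ u v = map (λ w → (χ u w , χ w v)) (allFin n)

WLSetoidⁿ : ℕ → Setoid 0ℓ 0ℓ → Setoid 0ℓ 0ℓ
WLSetoidⁿ zero    S = S
WLSetoidⁿ (suc m) S = WLSetoid (WLSetoidⁿ m S)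

wlIter : ∀ {n} (m : ℕ) {S : Setoid 0ℓ 0ℓ} → Coloring n S → Coloring n (WLSetoidⁿ m S)
wlIter zero    χ = χ
wlIter (suc m) {S} χ = wlStep {S = WLSetoidⁿ m S} (wlIter m χ)

allTuples : (n m : ℕ) → List (List (Fin n))
allTuples n zero    = [] ∷ []
allTuples n (suc m) = concatMap (λ w → map (w ∷_) (allTuples n m)) (allFin n)

chiBar : ∀ {n} {C : Set} → (Fin n → Fin n → C) → List (Fin n) → List C
chiBar χ []           = []
chiBar χ (x ∷ [])     = []
chiBar χ (x ∷ y ∷ xs) = χ x y ∷ chiBar χ (y ∷ xs)

WalkSetoid : Set → Setoid 0ℓ 0ℓ
WalkSetoid C = record
  { Carrier = List (List C)
  ; _≈_ = _↭_
  ; isEquivalence = Data.List.Relation.Binary.Permutation.Propositional.↭-isEquivalence }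
  where import Data.List.Relation.Binary.Permutation.Propositional

-- χ_{W[k]}(u,v) = {{ χ̄(u,w₁,…,w_{k-1},v) : w₁,…,w_{k-1} ∈ V }}.
-- (k is given as suc j, so the walk has j = k-1 inner vertices.)
walkRefine : ∀ {n} {C : Set} (k : ℕ) → (Fin n → Fin n → C) → Coloring n (WalkSetoid C)
walkRefine {n} zero    χ u v = []   -- unused (k ≥ 2 in the statement)
walkRefine {n} (suc j) χ u v =
  map (λ ws → chiBar χ (u ∷ ws ++ v ∷ [])) (allTuples n j)

-- Let W_j(u,v) be the multiset of colour sequences of the walks of length j from u to v.
-- Splitting a walk at its a-th vertex w gives W_{a+b}(u,v) = ⊎_w W_a(u,w) ⊗ W_b(w,v),
-- where ⊗ concatenates sequences.  The WL colour of (u,v) is the multiset of the pairs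
-- (χ(u,w), χ(w,v)), so if the colours of one round determine W_a and W_b, the next
-- round determines W_{a+b}; hence m rounds determine W_j for 2 ≤ j ≤ 2^m.  The case
-- j = 1 needs the loop colours, as a WL colour does not record the previous one: the
-- only walk u, w, v whose first step has a loop colour is u, u, v, so W_2(u,v)
-- determines χ(u,v).
module Submission where

open import Defs
open import Data.Nat using (ℕ; _≤_)
open import Data.Nat.Logarithm using (⌈log₂_⌉)
open import Data.Fin using (Fin)
open import Relation.Binary.PropositionalEquality using (_≡_; _≢_; setoid)

open import Level using (0ℓ)
open import Data.Empty using (⊥-elim)
open import Data.Fin using () renaming (_≟_ to _≟ᶠ_)
open import Data.Nat using (zero; suc; _+_; _^_; z≤n; s≤s; s≤s⁻¹; ⌊_/2⌋; ⌈_/2⌉)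
open import Data.Nat.Properties
  using ( ≤-trans; ≤-reflexive; +-suc; +-identityʳ; +-mono-≤; +-monoʳ-≤; +-monoˡ-≤; *-monoʳ-≤
        ; m^n>0; ⌊n/2⌋≤⌈n/2⌉; ⌈n/2⌉<n; ⌊n/2⌋+⌈n/2⌉≡n; ⌈n/2⌉-mono; n≡⌈n+n/2⌉
        ; module ≤-Reasoning)
open import Data.Nat.Logarithm.Core using (⌈log2⌉)
open import Data.List using (List; []; _∷_; [_]; map; concatMap; _++_; allFin)
open import Data.List.Properties
  using (map-++; map-∘; ++-assoc; ++-identityʳ; ∷-injectiveˡ; ∷-injectiveʳ
        ; concatMap-cong; concatMap-map; concatMap-pure; map-concatMap; concatMap-++)
open import Data.List.Relation.Unary.Any using (here)
open import Data.List.Relation.Unary.Any.Properties using (map⁻)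
open import Data.List.Membership.Propositional using (_∈_; find)
open import Data.List.Membership.Propositional.Properties using (∈-∃++; ∈-map⁺; ∈-map⁻; ∈-allFin)
open import Data.List.Relation.Binary.Permutation.Propositional
  using (_↭_; ↭-refl; ↭-reflexive; ↭-sym; ↭-trans; module PermutationReasoning)
import Data.List.Relation.Binary.Permutation.Propositional as ↭
open import Data.List.Relation.Binary.Permutation.Propositional.Properties
  using (++⁺; ++⁺ˡ; shifts; ∈-resp-↭; map⁺)
import Data.List.Relation.Binary.Permutation.Setoid as SetoidPermutation
import Data.List.Relation.Binary.Permutation.Setoid.Properties as SetoidPermutationProperties
open import Data.Product using (_×_; _,_; ∃; ∃₂)
open import Data.Product.Relation.Binary.Pointwise.NonDependent using (×-setoid)
open import Function using (_∘_)
open import Induction.WellFounded using (acc)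
open import Relation.Binary using (Setoid)
open import Relation.Binary.PropositionalEquality using (refl; sym; trans; cong; subst; module ≡-Reasoning)
open import Relation.Nullary using (yes; no)

module _ {A B : Set} where

  concatMap-cong-↭ : {f g : A → List B} → (∀ x → f x ↭ g x) →
                     ∀ xs → concatMap f xs ↭ concatMap g xs
  concatMap-cong-↭ f↭g []       = ↭-refl
  concatMap-cong-↭ f↭g (x ∷ xs) = ++⁺ (f↭g x) (concatMap-cong-↭ f↭g xs)

  concatMap-↭ : (f : A → List B) {xs ys : List A} → xs ↭ ys → concatMap f xs ↭ concatMap f ys
  concatMap-↭ f ↭.refl         = ↭-refl
  concatMap-↭ f (↭.prep x p)   = ++⁺ˡ (f x) (concatMap-↭ f p)
  concatMap-↭ f (↭.swap x y p) =
    ↭-trans (++⁺ˡ (f x) (++⁺ˡ (f y) (concatMap-↭ f p))) (shifts (f x) (f y))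
  concatMap-↭ f (↭.trans p q)  = ↭-trans (concatMap-↭ f p) (concatMap-↭ f q)

  concatMap-++-↭ : (f g : A → List B) (xs : List A) →
                   concatMap (λ x → f x ++ g x) xs ↭ concatMap f xs ++ concatMap g xs
  concatMap-++-↭ f g []       = ↭-refl
  concatMap-++-↭ f g (x ∷ xs) = begin
    (f x ++ g x) ++ concatMap (λ x → f x ++ g x) xs  ≡⟨ ++-assoc (f x) (g x) _ ⟩
    f x ++ g x ++ concatMap (λ x → f x ++ g x) xs    ↭⟨ ++⁺ˡ (f x) (++⁺ˡ (g x) (concatMap-++-↭ f g xs)) ⟩
    f x ++ g x ++ concatMap f xs ++ concatMap g xs   ↭⟨ ++⁺ˡ (f x) (shifts (g x) (concatMap f xs)) ⟩
    f x ++ concatMap f xs ++ g x ++ concatMap g xs   ≡⟨ ++-assoc (f x) (concatMap f xs) _ ⟨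
    (f x ++ concatMap f xs) ++ concatMap g (x ∷ xs)  ∎
    where open PermutationReasoning

module _ {A B D : Set} where

  concatMap-concatMap : (g : B → List D) (f : A → List B) (xs : List A) →
                        concatMap g (concatMap f xs) ≡ concatMap (concatMap g ∘ f) xs
  concatMap-concatMap g f []       = refl
  concatMap-concatMap g f (x ∷ xs) = begin
    concatMap g (f x ++ concatMap f xs)              ≡⟨ concatMap-++ g (f x) (concatMap f xs) ⟩
    concatMap g (f x) ++ concatMap g (concatMap f xs) ≡⟨ cong (concatMap g (f x) ++_) (concatMap-concatMap g f xs) ⟩
    concatMap g (f x) ++ concatMap (concatMap g ∘ f) xs ∎
    where open ≡-Reasoning

  concatMap-comm : (f : A → B → List D) (xs : List A) (ys : List B) →
                   concatMap (λ x → concatMap (f x) ys) xs ↭ concatMap (λ y → concatMap (λ x → f x y) xs) ys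
  concatMap-comm f []       ys = ↭-reflexive (sym (concatMap-[] ys))
    where
    concatMap-[] : ∀ ys → concatMap {A = B} {B = D} (λ _ → []) ys ≡ []
    concatMap-[] []       = refl
    concatMap-[] (_ ∷ ys) = concatMap-[] ys
  concatMap-comm f (x ∷ xs) ys =
    ↭-trans (++⁺ˡ (concatMap (f x) ys) (concatMap-comm f xs ys))
            (↭-sym (concatMap-++-↭ (f x) (λ y → concatMap (λ x → f x y) xs) ys))

module _ (S : Setoid 0ℓ 0ℓ) {X Y B : Set}
         {key₁ : X → Setoid.Carrier S} {key₂ : Y → Setoid.Carrier S}
         {val₁ : X → List B} {val₂ : Y → List B}
         (val-resp : ∀ x y → Setoid._≈_ S (key₁ x) (key₂ y) → val₁ x ↭ val₂ y) where

  open Setoid S using (_≈_) renaming (refl to ≈-refl; sym to ≈-sym)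
  open SetoidPermutation S using ()
    renaming (_↭_ to _↭ₛ_; ↭-sym to ↭ₛ-sym; ↭-trans to ↭ₛ-trans)
  open SetoidPermutationProperties S using (¬x∷xs↭[]; shift; drop-∷) renaming (∈-resp-↭ to ∈ₛ-resp-↭ₛ)

  private
    drop-matched : ∀ {a b as} bs₁ bs₂ → a ≈ b → a ∷ as ↭ₛ bs₁ ++ b ∷ bs₂ → as ↭ₛ bs₁ ++ bs₂
    drop-matched bs₁ bs₂ a≈b p = drop-∷ (↭ₛ-trans p (shift (≈-sym a≈b) bs₁ bs₂))

  concatMap-↭ₛ : ∀ xs ys → map key₁ xs ↭ₛ map key₂ ys → concatMap val₁ xs ↭ concatMap val₂ ys
  concatMap-↭ₛ []       []      _ = ↭-refl
  concatMap-↭ₛ []       (_ ∷ _) p = ⊥-elim (¬x∷xs↭[] (↭ₛ-sym p))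
  concatMap-↭ₛ (x ∷ xs) ys      p
    with y , y∈ys , kx≈ky ← find (map⁻ (∈ₛ-resp-↭ₛ p (here ≈-refl)))
    with ys₁ , ys₂ , refl ← ∈-∃++ y∈ys = begin
      val₁ x ++ concatMap val₁ xs                        ↭⟨ ++⁺ (val-resp x y kx≈ky) (concatMap-↭ₛ xs (ys₁ ++ ys₂) rest) ⟩
      val₂ y ++ concatMap val₂ (ys₁ ++ ys₂)              ≡⟨ cong (val₂ y ++_) (concatMap-++ val₂ ys₁ ys₂) ⟩
      val₂ y ++ concatMap val₂ ys₁ ++ concatMap val₂ ys₂ ↭⟨ shifts (val₂ y) (concatMap val₂ ys₁) ⟩
      concatMap val₂ ys₁ ++ val₂ y ++ concatMap val₂ ys₂ ≡⟨ concatMap-++ val₂ ys₁ (y ∷ ys₂) ⟨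
      concatMap val₂ (ys₁ ++ y ∷ ys₂)                    ∎
    where
    open PermutationReasoning
    rest : map key₁ xs ↭ₛ map key₂ (ys₁ ++ ys₂)
    rest = subst (map key₁ xs ↭ₛ_) (sym (map-++ key₂ ys₁ ys₂))
      (drop-matched (map key₂ ys₁) (map key₂ ys₂) kx≈ky (subst (_ ↭ₛ_) (map-++ key₂ ys₁ (y ∷ ys₂)) p))

module _ {C : Set} where

  infixl 7 _⊗_

  _⊗_ : List (List C) → List (List C) → List (List C)
  P ⊗ Q = concatMap (λ p → map (p ++_) Q) P

  ⊗-cong : {P P′ Q Q′ : List (List C)} → P ↭ P′ → Q ↭ Q′ → P ⊗ Q ↭ P′ ⊗ Q′
  ⊗-cong {P} {P′} {Q} P↭P′ Q↭Q′ =
    ↭-trans (concatMap-↭ (λ p → map (p ++_) Q) P↭P′) (concatMap-cong-↭ (λ p → map⁺ (p ++_) Q↭Q′) P′)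

  concatMap-⊗ : {A : Set} (f : A → List (List C)) (xs : List A) (Q : List (List C)) →
                concatMap f xs ⊗ Q ≡ concatMap (λ x → f x ⊗ Q) xs
  concatMap-⊗ f xs Q = concatMap-concatMap (λ p → map (p ++_) Q) f xs

  map-∷-⊗ : (c : C) (P Q : List (List C)) → map (c ∷_) P ⊗ Q ≡ map (c ∷_) (P ⊗ Q)
  map-∷-⊗ c P Q = begin
    concatMap (λ p → map (p ++_) Q) (map (c ∷_) P)    ≡⟨ concatMap-map (λ p → map (p ++_) Q) (c ∷_) P ⟩
    concatMap (λ p → map ((c ∷_) ∘ (p ++_)) Q) P      ≡⟨ concatMap-cong (λ p → map-∘ Q) P ⟩
    concatMap (λ p → map (c ∷_) (map (p ++_) Q)) P    ≡⟨ map-concatMap (c ∷_) (λ p → map (p ++_) Q) P ⟨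
    map (c ∷_) (P ⊗ Q)                                ∎
    where open ≡-Reasoning

module _ {n : ℕ} {C : Set} (χ : Fin n → Fin n → C) where

  walkRefine-suc : ∀ j u v → walkRefine (2 + j) χ u v ≡
                   concatMap (λ w → map (χ u w ∷_) (walkRefine (suc j) χ w v)) (allFin n)
  walkRefine-suc j u v = begin
    map walk (concatMap (λ w → map (w ∷_) (allTuples n j)) (allFin n))
      ≡⟨ map-concatMap walk (λ w → map (w ∷_) (allTuples n j)) (allFin n) ⟩
    concatMap (λ w → map walk (map (w ∷_) (allTuples n j))) (allFin n)
      ≡⟨ concatMap-cong (λ w → trans (sym (map-∘ (allTuples n j))) (map-∘ (allTuples n j))) (allFin n) ⟩
      -- walk (w ∷ ws) computes to χ u w ∷ chiBar χ (w ∷ ws ++ [ v ])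
    concatMap (λ w → map (χ u w ∷_) (walkRefine (suc j) χ w v)) (allFin n)
      ∎
    where
    open ≡-Reasoning
    walk : List (Fin n) → List C
    walk ws = chiBar χ (u ∷ ws ++ [ v ])

  walkRefine-2 : ∀ u v → walkRefine 2 χ u v ≡ map (λ w → χ u w ∷ χ w v ∷ []) (allFin n)
  walkRefine-2 u v = trans (walkRefine-suc 0 u v)
    (trans (sym (concatMap-map [_] (λ w → χ u w ∷ χ w v ∷ []) (allFin n))) (concatMap-pure _))

  walkRefine-suc-⊗ : ∀ a u w (Q : List (List C)) → walkRefine (2 + a) χ u w ⊗ Q ≡
                     concatMap (λ x → map (χ u x ∷_) (walkRefine (suc a) χ x w ⊗ Q)) (allFin n)
  walkRefine-suc-⊗ a u w Q = begin
    walkRefine (2 + a) χ u w ⊗ Q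
      ≡⟨ cong (_⊗ Q) (walkRefine-suc a u w) ⟩
    concatMap (λ x → map (χ u x ∷_) (walkRefine (suc a) χ x w)) (allFin n) ⊗ Q
      ≡⟨ concatMap-⊗ (λ x → map (χ u x ∷_) (walkRefine (suc a) χ x w)) (allFin n) Q ⟩
    concatMap (λ x → map (χ u x ∷_) (walkRefine (suc a) χ x w) ⊗ Q) (allFin n)
      ≡⟨ concatMap-cong (λ x → map-∷-⊗ (χ u x) (walkRefine (suc a) χ x w) Q) (allFin n) ⟩
    concatMap (λ x → map (χ u x ∷_) (walkRefine (suc a) χ x w ⊗ Q)) (allFin n)
      ∎
    where open ≡-Reasoning

  walkRefine-+ : ∀ a b u v → walkRefine (suc a + suc b) χ u v ↭
                 concatMap (λ w → walkRefine (suc a) χ u w ⊗ walkRefine (suc b) χ w v) (allFin n)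
  walkRefine-+ zero    b u v = ↭-reflexive (trans (walkRefine-suc b u v)
    (concatMap-cong (λ w → sym (++-identityʳ (map (χ u w ∷_) (walkRefine (suc b) χ w v)))) (allFin n)))
  walkRefine-+ (suc a) b u v = begin
    walkRefine (2 + (a + suc b)) χ u v
      ≡⟨ walkRefine-suc (a + suc b) u v ⟩
    concatMap (λ x → map (χ u x ∷_) (walkRefine (suc a + suc b) χ x v)) (allFin n)
      ↭⟨ concatMap-cong-↭ (λ x → map⁺ (χ u x ∷_) (walkRefine-+ a b x v)) (allFin n) ⟩
    concatMap (λ x → map (χ u x ∷_) (concatMap (λ w → Wa x w ⊗ Wb w v) (allFin n))) (allFin n)
      ≡⟨ concatMap-cong (λ x → map-concatMap (χ u x ∷_) (λ w → Wa x w ⊗ Wb w v) (allFin n)) (allFin n) ⟩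
    concatMap (λ x → concatMap (λ w → map (χ u x ∷_) (Wa x w ⊗ Wb w v)) (allFin n)) (allFin n)
      ↭⟨ concatMap-comm (λ x w → map (χ u x ∷_) (Wa x w ⊗ Wb w v)) (allFin n) (allFin n) ⟩
    concatMap (λ w → concatMap (λ x → map (χ u x ∷_) (Wa x w ⊗ Wb w v)) (allFin n)) (allFin n)
      ≡⟨ concatMap-cong (λ w → sym (walkRefine-suc-⊗ a u w (Wb w v))) (allFin n) ⟩
    concatMap (λ w → walkRefine (2 + a) χ u w ⊗ Wb w v) (allFin n)
      ∎
    where
    open PermutationReasoning
    Wa Wb : Fin n → Fin n → List (List C)
    Wa = walkRefine (suc a) χ
    Wb = walkRefine (suc b) χ

  χ⪯walkRefine-1 : _⪯_ {S = setoid C} {T = WalkSetoid C} χ (walkRefine 1 χ)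
  χ⪯walkRefine-1 _ _ _ _ χ≡ = ↭-reflexive (cong (λ c → [ [ c ] ]) χ≡)

  loop-walk∈walkRefine-2 : ∀ u v → χ u u ∷ χ u v ∷ [] ∈ walkRefine 2 χ u v
  loop-walk∈walkRefine-2 u v =
    subst (_ ∈_) (sym (walkRefine-2 u v)) (∈-map⁺ (λ w → χ u w ∷ χ w v ∷ []) (∈-allFin u))

  ∈walkRefine-2⁻ : ∀ {c d u v} → c ∷ d ∷ [] ∈ walkRefine 2 χ u v → ∃ λ w → c ≡ χ u w × d ≡ χ w v
  ∈walkRefine-2⁻ {u = u} {v} cd∈
    with w , _ , cd≡ ← ∈-map⁻ (λ w → χ u w ∷ χ w v ∷ []) (subst (_ ∈_) (walkRefine-2 u v) cd∈)
    = w , ∷-injectiveˡ cd≡ , ∷-injectiveˡ (∷-injectiveʳ cd≡)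

  walkRefine-2⪯χ : (∀ (u v w : Fin n) → v ≢ w → χ u u ≢ χ v w) →
                   _⪯_ {S = WalkSetoid C} {T = setoid C} (walkRefine 2 χ) χ
  walkRefine-2⪯χ loop-colours u v u′ v′ W≈W′
    with w , χuu≡χu′w , χuv≡χwv′ ← ∈walkRefine-2⁻ (∈-resp-↭ W≈W′ (loop-walk∈walkRefine-2 u v))
    with u′ ≟ᶠ w
  ... | yes refl = χuv≡χwv′
  ... | no u′≢w  = ⊥-elim (loop-colours u u′ w u′≢w χuu≡χu′w)

wlStep-⪯-⊗ : ∀ {n} {S : Setoid 0ℓ 0ℓ} {C : Set} (χ : Coloring n S) (A B : Fin n → Fin n → List (List C)) →
             _⪯_ {S = S} {T = WalkSetoid C} χ A → _⪯_ {S = S} {T = WalkSetoid C} χ B →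
             _⪯_ {S = WLSetoid S} {T = WalkSetoid C} (wlStep {S = S} χ) (λ u v → concatMap (λ w → A u w ⊗ B w v) (allFin n))
wlStep-⪯-⊗ {n} {S} χ A B χ⪯A χ⪯B u v u′ v′ =
  concatMap-↭ₛ (×-setoid S S) (λ w w′ (uw≈u′w′ , wv≈w′v′) → ⊗-cong (χ⪯A u w u′ w′ uw≈u′w′) (χ⪯B w v w′ v′ wv≈w′v′))
    (allFin n) (allFin n)

2^suc≡2^+2^ : ∀ m → 2 ^ suc m ≡ 2 ^ m + 2 ^ m
2^suc≡2^+2^ m = cong (2 ^ m +_) (+-identityʳ (2 ^ m))

split-≤-double : ∀ {j N} → 2 ≤ j → j ≤ N + N → ∃₂ λ a b → j ≡ suc a + suc b × suc a ≤ N × suc b ≤ N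
split-≤-double {suc (suc t)} {suc N} (s≤s (s≤s _)) (s≤s 1+t≤N+1+N) =
  ⌊ t /2⌋ , ⌈ t /2⌉ , 2+t≡ , ≤-trans (s≤s (⌊n/2⌋≤⌈n/2⌉ t)) 1+⌈t/2⌉≤1+N , 1+⌈t/2⌉≤1+N
  where
  1+⌈t/2⌉≤1+N : suc ⌈ t /2⌉ ≤ suc N
  1+⌈t/2⌉≤1+N = s≤s (≤-trans (⌈n/2⌉-mono (s≤s⁻¹ (subst (suc t ≤_) (+-suc N N) 1+t≤N+1+N)))
                             (≤-reflexive (sym (n≡⌈n+n/2⌉ N))))
  2+t≡ : 2 + t ≡ suc ⌊ t /2⌋ + suc ⌈ t /2⌉
  2+t≡ = cong suc (trans (cong suc (sym (⌊n/2⌋+⌈n/2⌉≡n t))) (sym (+-suc ⌊ t /2⌋ ⌈ t /2⌉)))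

≤2^⌈log2⌉ : ∀ k {acc} → k ≤ 2 ^ ⌈log2⌉ k acc
≤2^⌈log2⌉ zero                = z≤n
≤2^⌈log2⌉ (suc zero)          = s≤s z≤n
≤2^⌈log2⌉ (suc (suc k)) {acc rs} = begin
  2 + k                            ≡⟨ cong (2 +_) (⌊n/2⌋+⌈n/2⌉≡n k) ⟨
  2 + (⌊ k /2⌋ + ⌈ k /2⌉)          ≤⟨ +-monoʳ-≤ 2 (+-monoˡ-≤ ⌈ k /2⌉ (⌊n/2⌋≤⌈n/2⌉ k)) ⟩
  2 + (⌈ k /2⌉ + ⌈ k /2⌉)          ≡⟨ cong suc (+-suc ⌈ k /2⌉ ⌈ k /2⌉) ⟨
  suc ⌈ k /2⌉ + suc ⌈ k /2⌉        ≤⟨ +-mono-≤ half≤ half≤ ⟩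
  2 ^ r + 2 ^ r                    ≡⟨ 2^suc≡2^+2^ r ⟨
  2 ^ suc r                        ∎
  where
  open ≤-Reasoning
  r = ⌈log2⌉ (suc ⌈ k /2⌉) (rs (⌈n/2⌉<n k))
  half≤ : suc ⌈ k /2⌉ ≤ 2 ^ r
  half≤ = ≤2^⌈log2⌉ (suc ⌈ k /2⌉)

≤2^⌈log₂⌉ : ∀ k → k ≤ 2 ^ ⌈log₂ k ⌉
≤2^⌈log₂⌉ k = ≤2^⌈log2⌉ k

module _ {n : ℕ} {C : Set} (χ : Fin n → Fin n → C) where

  WLRefinesWalks : ℕ → ℕ → Set
  WLRefinesWalks m j = _⪯_ {S = WLSetoidⁿ m (setoid C)} {T = WalkSetoid C} (wlIter m χ) (walkRefine j χ)

  WLRefinesWalks-double : ∀ m → (∀ {j} → 1 ≤ j → j ≤ 2 ^ m → WLRefinesWalks m j) →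
                          ∀ {j} → 2 ≤ j → j ≤ 2 ^ suc m → WLRefinesWalks (suc m) j
  WLRefinesWalks-double m refines {j} 2≤j j≤2^1+m u v u′ v′ c≈c′
    with a , b , refl , 1+a≤ , 1+b≤ ← split-≤-double {N = 2 ^ m} 2≤j (subst (j ≤_) (2^suc≡2^+2^ m) j≤2^1+m) =
    ↭-trans (walkRefine-+ χ a b u v)
      (↭-trans (wlStep-⪯-⊗ {S = WLSetoidⁿ m (setoid C)} (wlIter m χ) (walkRefine (suc a) χ) (walkRefine (suc b) χ)
                            (refines (s≤s z≤n) 1+a≤) (refines (s≤s z≤n) 1+b≤) u v u′ v′ c≈c′)
               (↭-sym (walkRefine-+ χ a b u′ v′)))

  wlIter-⪯-walkRefine : (∀ (u v w : Fin n) → v ≢ w → χ u u ≢ χ v w) →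
                        ∀ m {j} → 1 ≤ j → j ≤ 2 ^ m → WLRefinesWalks m j
  wlIter-⪯-walkRefine loop-colours zero    {suc zero}    _ _       = χ⪯walkRefine-1 χ
  wlIter-⪯-walkRefine loop-colours zero    {suc (suc _)} _ (s≤s ())
  wlIter-⪯-walkRefine loop-colours (suc m) {suc (suc _)} _ j≤2^1+m =
    WLRefinesWalks-double m (wlIter-⪯-walkRefine loop-colours m) (s≤s (s≤s z≤n)) j≤2^1+m
  wlIter-⪯-walkRefine loop-colours (suc m) {suc zero}    _ _ u v u′ v′ =
    χ⪯walkRefine-1 χ u v u′ v′ ∘ walkRefine-2⪯χ χ loop-colours u v u′ v′ ∘ refines-2 u v u′ v′
    where
    refines-2 : WLRefinesWalks (suc m) 2
    refines-2 = WLRefinesWalks-double m (wlIter-⪯-walkRefine loop-colours m) (s≤s (s≤s z≤n))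
                                      (*-monoʳ-≤ 2 (m^n>0 2 m))

lemma3 : (n : ℕ) (C : Set) (χ : Fin n → Fin n → C)
    → (∀ (u v w : Fin n) → v ≢ w → χ u u ≢ χ v w)
    → (k : ℕ) → 2 ≤ k
    → _⪯_ {n} {WLSetoidⁿ ⌈log₂ k ⌉ (setoid C)} {WalkSetoid C}
        (wlIter ⌈log₂ k ⌉ {setoid C} χ) (walkRefine k χ)
lemma3 n C χ loop-colours k 2≤k =
  wlIter-⪯-walkRefine χ loop-colours ⌈log₂ k ⌉ (≤-trans (s≤s z≤n) 2≤k) (≤2^⌈log₂⌉ k)
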